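{- Let $(X,\vartriangleleft)$ be a relational frame. Then: (1) the $c_\vartriangleleft$-fixpoints, ordered by $\subseteq$, form a complete lattice $\mathfrak{L}(X,\vartriangleleft)$ in which $\bigwedge_i A_i=\bigcap_i A_i$ and $\bigvee_i A_i=c_\vartriangleleft(\bigcup_i A_i)$; (2) $\neg_\vartriangleleft$ is a precomplementation on $\mathfrak{L}(X,\vartriangleleft)$; (3) if $\vartriangleleft$ is reflexive, then $\neg_\vartriangleleft$ is a protocomplementation on $\mathfrak{L}(X,\vartriangleleft)$.
   Context: A relational frame is a pair $(X,\vartriangleleft)$ of a nonempty set $X$ and a binary relation $\vartriangleleft$ on $X$; write $y\vartriangleright x$ for $x\vartriangleleft y$. Define $c_\vartriangleleft:\wp(X)\to\wp(X)$ by $c_\vartriangleleft(A)=\{x\in X\mid \forall x'\vartriangleleft x\ \exists x''\vartriangleright x':\ x''\in A\}$ (a closure operator); $A$ is a $c_\vartriangleleft$-fixpoint if $c_\vartriangleleft(A)=A$. Define $\neg_\vartriangleleft A=\{x\in X\mid \forall y\vartriangleleft x,\ y\notin A\}$ (which maps $c_\vartriangleleft$-fixpoints to $c_\vartriangleleft$-fixpoints). A precomplementation on a bounded lattice is an antitone unary operation $\neg$ (i.e., $a\le b$ implies $\neg b\le\neg a$) with $\neg 1=0$. A protocomplementation is an antitone unary operation $\neg$ with $a\wedge\neg a=0$ for all $a$ and $\neg 0=1$. -}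

module Defs where

open import Level using (Level; _⊔_)
open import Data.Product using (Σ; _×_; _,_; ∃-syntax)
open import Relation.Nullary using (¬_)
open import Relation.Unary using (Pred; _⊆_; _≐_; _∈_; ∅)
open import Relation.Binary using (Rel)

-- A relational frame (X, ◁): X a set, ◁ a binary relation on X
-- (nonemptiness of X is a separate hypothesis in the statement).
-- Subsets of X are predicates  Pred X p.

module _ {a r : Level} {X : Set a} (_◁_ : Rel X r) where

  c : ∀ {p} → Pred X p → Pred X (a ⊔ r ⊔ p)
  c A x = ∀ x' → x' ◁ x → ∃[ x'' ] (x' ◁ x'' × x'' ∈ A)

  Fixpoint : ∀ {p} → Pred X p → Set (a ⊔ r ⊔ p)
  Fixpoint A = c A ≐ A

  neg : ∀ {p} → Pred X p → Pred X (a ⊔ r ⊔ p)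
  neg A x = ∀ y → y ◁ x → ¬ (y ∈ A)

  -- bottom element of 𝔏(X,◁): the join of the empty family, c_◁(∅)
  Bot : Pred X (a ⊔ r)
  Bot = c ∅

{-# OPTIONS --safe #-}
module Submission where

-- c_◁ is a closure operator, so its fixpoints are closed under intersections and the
-- least fixpoint above a set is its closure; this gives the complete lattice. Every
-- ¬_◁ A is already closed, and ¬_◁ is antitone because it quantifies over A negatively.
-- Both ¬_◁ X and c_◁ ∅ consist of the ◁-minimal points; when ◁ is reflexive there are
-- none, so the bottom is empty, A ∩ ¬_◁ A is empty since x ◁ x, and ¬_◁ ∅ = X.

open import Defs
open import Level using (Level)
open import Data.Product using (_×_; _,_; proj₁; proj₂)
open import Data.Empty using (⊥-elim)
open import Data.Unit using (tt)
open import Relation.Unary using (Pred; _⊆_; _≐_; _∩_; ⋂; ⋃; U; ∅)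
open import Relation.Binary using (Rel; Reflexive)

module _ {a r : Level} {X : Set a} (_◁_ : Rel X r) where

  c-extensive : ∀ {p} {A : Pred X p} → A ⊆ c _◁_ A
  c-extensive {x = x} x∈A x' x'◁x = x , x'◁x , x∈A

  c-monotonic : ∀ {p q} {A : Pred X p} {B : Pred X q} → A ⊆ B → c _◁_ A ⊆ c _◁_ B
  c-monotonic A⊆B x∈cA x' x'◁x =
    let x'' , x'◁x'' , x''∈A = x∈cA x' x'◁x in x'' , x'◁x'' , A⊆B x''∈A

  c-idempotent : ∀ {p} {A : Pred X p} → c _◁_ (c _◁_ A) ⊆ c _◁_ A
  c-idempotent x∈ccA x' x'◁x =
    let x'' , x'◁x'' , x''∈cA = x∈ccA x' x'◁x in x''∈cA x' x'◁x''

  c-fixpoint : ∀ {p} {A : Pred X p} → Fixpoint _◁_ (c _◁_ A)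
  c-fixpoint = c-idempotent , c-extensive

  c-least : ∀ {p q} {A : Pred X p} {B : Pred X q} → Fixpoint _◁_ B → A ⊆ B → c _◁_ A ⊆ B
  c-least (cB⊆B , _) A⊆B x∈cA = cB⊆B (c-monotonic A⊆B x∈cA)

  ⋂-fixpoint : ∀ {i p} {I : Set i} {A : I → Pred X p} →
               (∀ j → Fixpoint _◁_ (A j)) → Fixpoint _◁_ (⋂ I A)
  ⋂-fixpoint fixA = (λ x∈c⋂ j → proj₁ (fixA j) (c-monotonic (λ x∈⋂ → x∈⋂ j) x∈c⋂))
                  , c-extensive

  neg-fixpoint : ∀ {p} {A : Pred X p} → Fixpoint _◁_ (neg _◁_ A)
  neg-fixpoint = (λ x∈cnegA y y◁x y∈A →
                   let z , y◁z , z∈negA = x∈cnegA y y◁x in z∈negA y y◁z y∈A)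
               , c-extensive

  neg-antitone : ∀ {p q} {A : Pred X p} {B : Pred X q} → A ⊆ B → neg _◁_ B ⊆ neg _◁_ A
  neg-antitone A⊆B x∈negB y y◁x y∈A = x∈negB y y◁x (A⊆B y∈A)

  neg-U≐Bot : neg _◁_ U ≐ Bot _◁_
  neg-U≐Bot = (λ x∈negU y y◁x → ⊥-elim (x∈negU y y◁x tt))
            , (λ x∈Bot y y◁x _ → proj₂ (proj₂ (x∈Bot y y◁x)))

  module _ (◁-refl : Reflexive _◁_) where

    Bot-empty : Bot _◁_ ⊆ ∅
    Bot-empty x∈Bot = proj₂ (proj₂ (x∈Bot _ ◁-refl))

    ∩-neg≐Bot : ∀ {p} {A : Pred X p} → A ∩ neg _◁_ A ≐ Bot _◁_
    ∩-neg≐Bot = (λ (x∈A , x∈negA) → ⊥-elim (x∈negA _ ◁-refl x∈A))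
              , (λ x∈Bot → ⊥-elim (Bot-empty x∈Bot))

    neg-Bot≐U : neg _◁_ (Bot _◁_) ≐ U
    neg-Bot≐U = (λ _ → tt) , (λ _ y _ y∈Bot → Bot-empty y∈Bot)

proposition4p5 : {ℓ : Level} (X : Set ℓ) (_◁_ : Rel X ℓ) → X →
    -- (1) complete lattice of fixpoints: meets are intersections ...
    ((I : Set ℓ) (A : I → Pred X ℓ) → (∀ i → Fixpoint _◁_ (A i)) →
      Fixpoint _◁_ (⋂ I A)
      × (∀ i → ⋂ I A ⊆ A i)
      × ((B : Pred X ℓ) → Fixpoint _◁_ B → (∀ i → B ⊆ A i) → B ⊆ ⋂ I A))
    -- ... and joins are closures of unions
    × ((I : Set ℓ) (A : I → Pred X ℓ) → (∀ i → Fixpoint _◁_ (A i)) →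
      Fixpoint _◁_ (c _◁_ (⋃ I A))
      × (∀ i → A i ⊆ c _◁_ (⋃ I A))
      × ((B : Pred X ℓ) → Fixpoint _◁_ B → (∀ i → A i ⊆ B) → c _◁_ (⋃ I A) ⊆ B))
    -- (2) neg is a precomplementation on the lattice of fixpoints
    × ((A : Pred X ℓ) → Fixpoint _◁_ A → Fixpoint _◁_ (neg _◁_ A))
    × ((A B : Pred X ℓ) → Fixpoint _◁_ A → Fixpoint _◁_ B → A ⊆ B → neg _◁_ B ⊆ neg _◁_ A)
    × (neg _◁_ U ≐ Bot _◁_)
    -- (3) if ◁ is reflexive, neg is a protocomplementation
    × (Reflexive _◁_ →
      ((A : Pred X ℓ) → Fixpoint _◁_ A → (A ∩ neg _◁_ A) ≐ Bot _◁_)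
      × (neg _◁_ (Bot _◁_) ≐ U))
proposition4p5 X _◁_ _ =
    (λ I A fixA → ⋂-fixpoint _◁_ fixA
                , (λ j x∈⋂ → x∈⋂ j)
                , (λ B _ B⊆A x∈B j → B⊆A j x∈B))
  , (λ I A _ → c-fixpoint _◁_
             , (λ j x∈A → c-extensive _◁_ (j , x∈A))
             , (λ B fixB A⊆B → c-least _◁_ fixB (λ (j , x∈A) → A⊆B j x∈A)))
  , (λ A _ → neg-fixpoint _◁_)
  , (λ A B _ _ → neg-antitone _◁_)
  , neg-U≐Bot _◁_
  , λ ◁-refl → (λ A _ → ∩-neg≐Bot _◁_ ◁-refl) , neg-Bot≐U _◁_ ◁-refl
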